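{- Let $p$ be a prime with $p-1=2^iq_1^{j_1}q_2^{j_2}$, where $q_1\neq q_2$ are odd primes and $i,j_1,j_2\ge 1$. For any generators $g_1,g_2$ of $\mathbb{Z}_p^*$, exactly one of the following holds: $\mathcal{M}(g_1)\cap\mathcal{M}(g_2)=\emptyset$, or $\mathcal{M}(g_1)=\mathcal{M}(g_2)$.
   Context: $\mathcal{G}$ is the set of generators of $\mathbb{Z}_p^*$, $\mathcal{R}$ the set of quadratic residues in $\mathbb{Z}_p^*$. For $g\in\mathcal{G}$: $\mathcal{R}_g=\{r\in\mathcal{R}: gr\in\mathcal{G}\}$, $\mathcal{I}(g)=\mathcal{R}_g\cap\mathcal{R}_{g^{ -1}}$, $\mathcal{M}(g)=\mathcal{G}\setminus\{gr,\ g^{ -1}r : r\in\mathcal{I}(g)\}$ (products mod $p$). -}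

module Defs where

open import Data.Nat using (ℕ; _+_; _*_; _∸_; _^_; _<_; _≤_; NonZero)
open import Data.Nat.DivMod using (_%_)
open import Data.Product using (_×_; ∃-syntax)
open import Data.Sum using (_⊎_)
open import Data.Empty using (⊥)
open import Relation.Nullary using (¬_)
open import Relation.Binary.PropositionalEquality using (_≡_; _≢_)

-- Elements of ℤ_p^* are represented by naturals x with 0 < x < p;
-- multiplication is (x * y) % p.

module _ (p : ℕ) .{{_ : NonZero p}} where

  Unit : ℕ → Set
  Unit x = 0 < x × x < p

  IsGen : ℕ → Set
  IsGen x = Unit x × (∀ k → 0 < k → k < p ∸ 1 → (x ^ k) % p ≢ 1)

  IsQR : ℕ → Set
  IsQR r = Unit r × ∃[ y ] (y * y) % p ≡ r

  IsInv : ℕ → ℕ → Set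
  IsInv g h = Unit h × (g * h) % p ≡ 1

  Rg : ℕ → ℕ → Set
  Rg g r = IsQR r × IsGen ((g * r) % p)

  -- 𝓘(g) = ℛ_g ∩ ℛ_{g⁻¹}
  Ig : ℕ → ℕ → Set
  Ig g r = Rg g r × (∀ h → IsInv g h → Rg h r)

  -- 𝓜(g) = 𝒢 ∖ { g r , g⁻¹ r : r ∈ 𝓘(g) }
  Mg : ℕ → ℕ → Set
  Mg g x = IsGen x ×
    ¬ (∃[ r ] (Ig g r × (x ≡ (g * r) % p ⊎ ∃[ h ] (IsInv g h × x ≡ (h * r) % p))))

Disjoint : (ℕ → Set) → (ℕ → Set) → Set
Disjoint A B = ∀ x → A x → B x → ⊥

SameSet : (ℕ → Set) → (ℕ → Set) → Set
SameSet A B = ∀ x → (A x → B x) × (B x → A x)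

module Submission where

-- Fix a generator γ, put n = p - 1 and write g = γ^c.  A residue r lies in 𝓘(g) iff r = γ^s
-- with s even and c ± s units mod n, so 𝓜(g) consists of the γ^a with a a unit mod n but
-- a + 2c and a - 2c not.  As a and c are odd, each of a ± 2c is divisible by q₁ or q₂, and not
-- both by the same q since q ∤ 2a.  Hence either a ≡ -2c (mod q₁) and a ≡ 2c (mod q₂), or the
-- same with the signs swapped: 𝓜(g) is a pair of classes modulo q₁q₂ exchanged by a ↦ -a.
-- Two such pairs are equal as soon as they meet, and each is nonempty by the Chinese
-- remainder theorem.

open import Defs
open import Data.Empty using (⊥; ⊥-elim)
open import Data.Fin using (Fin; zero; suc; toℕ; fromℕ<)
open import Data.Fin.Properties
  using (any?; injective⇒≤; toℕ-injective; toℕ<n; fromℕ<-injective)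
  renaming (_≟_ to _≟ᶠ_)
open import Data.Nat
open import Data.Nat.Coprimality using (Coprime; coprime?; coprime-Bézout; coprime-divisor)
  renaming (sym to coprime-sym)
open import Data.Nat.DivMod hiding (_mod_)
open import Data.Nat.Divisibility
open import Data.Nat.GCD using (module Bézout)
open import Data.Nat.Primality
open import Data.Nat.Properties
open import Data.Nat.Tactic.RingSolver using (solve-∀)
open import Data.Product using (∃; ∃-syntax; _×_; _,_; proj₁; proj₂)
open import Data.Sum using (_⊎_; inj₁; inj₂) renaming (swap to ⊎-swap)
open import Function.Base using (_∘_)
open import Function.Definitions using (Injective)
open import Relation.Binary.Definitions using (tri<; tri≈; tri>)
open import Relation.Binary.PropositionalEquality
open import Relation.Nullary using (¬_; Dec; yes; no; contradiction)
open import Relation.Nullary.Decidable using (map′; _×-dec_)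

open ≡-Reasoning

infix 4 _≡_mod_
_≡_mod_ : ℕ → ℕ → (d : ℕ) → .{{NonZero d}} → Set
a ≡ b mod d = a % d ≡ b % d

∣m+n∣n⇒∣m : ∀ {d m n} → d ∣ m + n → d ∣ n → d ∣ m
∣m+n∣n⇒∣m {d} {m} {n} d∣m+n = ∣m+n∣m⇒∣n (subst (d ∣_) (+-comm m n) d∣m+n)

∣-+-comm : ∀ {d} m n → d ∣ m + n → d ∣ n + m
∣-+-comm {d} m n = subst (d ∣_) (+-comm m n)

∣-rearrange : ∀ {d x y z w} → x + y ≡ z + w → d ∣ y → d ∣ z → d ∣ w → d ∣ x
∣-rearrange {d} eq d∣y d∣z d∣w =
  ∣m+n∣n⇒∣m (subst (d ∣_) (sym eq) (∣m∣n⇒∣m+n d∣z d∣w)) d∣y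

m∣m^n : ∀ {m n} → 1 ≤ n → m ∣ m ^ n
m∣m^n {m} {suc n} _ = m∣m*n (m ^ n)

m+m≡m*2 : ∀ m → m + m ≡ m * 2
m+m≡m*2 = solve-∀

m+k≡m⇒∣k : ∀ m k {d} .{{_ : NonZero d}} → m + k ≡ m mod d → d ∣ k
m+k≡m⇒∣k m k {d} eq =
  ∣m+n∣n⇒∣m (subst (d ∣_) (sym quotients) (n∣m*n ((m + k) / d))) (n∣m*n (m / d))
  where
  rearrange : ∀ r k q → r + (k + q) ≡ r + q + k
  rearrange = solve-∀
  quotients : k + m / d * d ≡ (m + k) / d * d
  quotients = +-cancelˡ-≡ (m % d) _ _ (begin
    m % d + (k + m / d * d)        ≡⟨ rearrange (m % d) k (m / d * d) ⟩
    m % d + m / d * d + k          ≡⟨ cong (_+ k) (m≡m%n+[m/n]*n m d) ⟨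
    m + k                          ≡⟨ m≡m%n+[m/n]*n (m + k) d ⟩
    (m + k) % d + (m + k) / d * d  ≡⟨ cong (_+ (m + k) / d * d) eq ⟩
    m % d + (m + k) / d * d        ∎)

mod-+ʳ : ∀ {a b} w {d} .{{_ : NonZero d}} → a ≡ b mod d → a + w ≡ b + w mod d
mod-+ʳ {a} {b} w {d} eq = begin
  (a + w) % d          ≡⟨ %-distribˡ-+ a w d ⟩
  (a % d + w % d) % d  ≡⟨ cong (λ x → (x + w % d) % d) eq ⟩
  (b % d + w % d) % d  ≡⟨ %-distribˡ-+ b w d ⟨
  (b + w) % d          ∎

prime∣m*n∧∤m⇒∣n : ∀ {p m n} → Prime p → p ∣ m * n → ¬ p ∣ m → p ∣ n
prime∣m*n∧∤m⇒∣n {p} {m} {n} p-prime p∣m*n p∤m with euclidsLemma m n p-prime p∣m*n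
... | inj₁ p∣m = contradiction p∣m p∤m
... | inj₂ p∣n = p∣n

private
  *-cancelˡ-mod-≤ : ∀ {p w u v} .{{_ : NonZero p}} → Prime p → ¬ p ∣ w → u ≤ v →
                    w * u ≡ w * v mod p → v ≡ u mod p
  *-cancelˡ-mod-≤ {p} {w} {u} p-prime p∤w u≤v eq with t , refl ← m≤n⇒∃[o]m+o≡n u≤v =
    %-remove-+ʳ u (prime∣m*n∧∤m⇒∣n p-prime p∣w*t p∤w)
    where
    p∣w*t : p ∣ w * t
    p∣w*t = m+k≡m⇒∣k (w * u) (w * t) (trans (cong (_% p) (sym (*-distribˡ-+ w u t))) (sym eq))

*-cancelˡ-mod : ∀ {p w u v} .{{_ : NonZero p}} → Prime p → ¬ p ∣ w →
                w * u ≡ w * v mod p → u ≡ v mod p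
*-cancelˡ-mod {u = u} {v} p-prime p∤w eq with ≤-total u v
... | inj₁ u≤v = sym (*-cancelˡ-mod-≤ p-prime p∤w u≤v eq)
... | inj₂ v≤u = *-cancelˡ-mod-≤ p-prime p∤w v≤u (sym eq)

[m%d]^k≡m^k : ∀ m k d .{{_ : NonZero d}} → (m % d) ^ k ≡ m ^ k mod d
[m%d]^k≡m^k m zero    d = refl
[m%d]^k≡m^k m (suc k) d = begin
  (m % d * (m % d) ^ k) % d            ≡⟨ %-distribˡ-* (m % d) ((m % d) ^ k) d ⟩
  (m % d % d * ((m % d) ^ k % d)) % d  ≡⟨ cong₂ (λ x y → (x * y) % d)
                                            (m%n%n≡m%n m d) ([m%d]^k≡m^k m k d) ⟩
  (m % d * (m ^ k % d)) % d            ≡⟨ %-distribˡ-* m (m ^ k) d ⟨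
  (m * m ^ k) % d                      ∎

cancel-negative : ∀ {c c'} a {d} .{{_ : NonZero d}} → d ∣ c + c' → c' + (a + c) ≡ a mod d
cancel-negative {c} {c'} a {d} d∣c+c' = begin
  (c' + (a + c)) % d  ≡⟨ cong (_% d) (rearrange c' a c) ⟩
  (a + (c + c')) % d  ≡⟨ %-remove-+ʳ a d∣c+c' ⟩
  a % d               ∎
  where
  rearrange : ∀ c' a c → c' + (a + c) ≡ a + (c + c')
  rearrange = solve-∀

negative-unique : ∀ {c c' c''} {d} .{{_ : NonZero d}} → d ∣ c + c' → d ∣ c + c'' → c' ≡ c'' mod d
negative-unique {c} {c'} {c''} {d} d∣c+c' d∣c+c'' = begin
  c' % d                ≡⟨ %-remove-+ʳ c' d∣c+c'' ⟨
  (c' + (c + c'')) % d  ≡⟨ cong (_% d) (rearrange c' c c'') ⟩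
  (c'' + (c + c')) % d  ≡⟨ %-remove-+ʳ c'' d∣c+c' ⟩
  c'' % d               ∎
  where
  rearrange : ∀ c' c c'' → c' + (c + c'') ≡ c'' + (c + c')
  rearrange = solve-∀

shift-by-negative : ∀ c c' {a s d} .{{_ : NonZero d}} → d ∣ c + c' → a ≡ c' + s mod d →
                    a + 2 * c ≡ c + s mod d
shift-by-negative c c' {a} {s} {d} d∣c+c' a≡c'+s = begin
  (a + 2 * c) % d         ≡⟨ mod-+ʳ (2 * c) a≡c'+s ⟩
  (c' + s + 2 * c) % d    ≡⟨ cong (_% d) (rearrange c c' s) ⟩
  (c + s + (c + c')) % d  ≡⟨ %-remove-+ʳ (c + s) d∣c+c' ⟩
  (c + s) % d             ∎
  where
  rearrange : ∀ c c' s → c' + s + 2 * c ≡ c + s + (c + c')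
  rearrange = solve-∀

negate : ℕ → ℕ → ℕ
negate d c = pred d * c

∣+negate : ∀ c d .{{_ : NonZero d}} → d ∣ c + negate d c
∣+negate c d = subst (λ k → d ∣ k * c) (sym (suc-pred d)) (m∣m*n c)

prime≢1 : ∀ {p} → Prime p → p ≢ 1
prime≢1 p-prime = nonTrivial⇒≢1 {{prime⇒nonTrivial p-prime}}

prime∤⇒∤^ : ∀ {p x} → Prime p → ¬ p ∣ x → ∀ k → ¬ p ∣ x ^ k
prime∤⇒∤^ p-prime p∤x zero    p∣1   = prime≢1 p-prime (∣1⇒≡1 p∣1)
prime∤⇒∤^ p-prime p∤x (suc k) p∣x^k =
  prime∤⇒∤^ p-prime p∤x k (prime∣m*n∧∤m⇒∣n p-prime p∣x^k p∤x)

odd⇒2∤ : ∀ {q} → q % 2 ≡ 1 → ¬ 2 ∣ q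
odd⇒2∤ {q} q-odd 2∣q with trans (sym q-odd) (n∣m⇒m%n≡0 q 2 2∣q)
... | ()

2∤⇒odd : ∀ a → ¬ 2 ∣ a → a % 2 ≡ 1
2∤⇒odd a 2∤a with a % 2 in a%2 | m%n<n a 2
... | 0           | _               = contradiction (m%n≡0⇒n∣m a 2 a%2) 2∤a
... | 1           | _               = refl
... | suc (suc _) | s≤s (s≤s ())

odd+odd⇒2∣ : ∀ {a b} → ¬ 2 ∣ a → ¬ 2 ∣ b → 2 ∣ a + b
odd+odd⇒2∣ {a} {b} 2∤a 2∤b = m%n≡0⇒n∣m (a + b) 2 (begin
  (a + b) % 2          ≡⟨ %-distribˡ-+ a b 2 ⟩
  (a % 2 + b % 2) % 2  ≡⟨ cong₂ (λ x y → (x + y) % 2) (2∤⇒odd a 2∤a) (2∤⇒odd b 2∤b) ⟩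
  0                    ∎)

oddPrime∣2*a⇒∣a : ∀ {q a} → Prime q → q % 2 ≡ 1 → q ∣ 2 * a → q ∣ a
oddPrime∣2*a⇒∣a {q} q-prime q-odd q∣2a = prime∣m*n∧∤m⇒∣n q-prime q∣2a q∤2
  where
  q∤2 : ¬ q ∣ 2
  q∤2 q∣2 with prime⇒irreducible prime[2] q∣2
  ... | inj₁ refl = prime≢1 q-prime refl
  ... | inj₂ refl = contradiction q-odd λ ()

∣⇒¬coprime : ∀ {q x n} → q ≢ 1 → q ∣ x → q ∣ n → ¬ Coprime x n
∣⇒¬coprime q≢1 q∣x q∣n x⊥n = q≢1 (x⊥n (q∣x , q∣n))

coprime-to-even⇒odd : ∀ {a n} → 2 ∣ n → Coprime a n → ¬ 2 ∣ a
coprime-to-even⇒odd 2∣n a⊥n 2∣a = ∣⇒¬coprime (λ ()) 2∣a 2∣n a⊥n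

coprime-mod : ∀ {a b n} .{{_ : NonZero n}} → a ≡ b mod n → Coprime a n → Coprime b n
coprime-mod {a} {b} {n} a≡b a⊥n (d∣b , d∣n) =
  a⊥n (∣n∣m%n⇒∣m d∣n (subst (_ ∣_) (sym a≡b) (%-presˡ-∣ d∣b d∣n)) , d∣n)

coprime-negative : ∀ {c c' n} → n ∣ c + c' → Coprime c n → Coprime c' n
coprime-negative n∣c+c' c⊥n (d∣c' , d∣n) = c⊥n (∣m+n∣n⇒∣m (∣-trans d∣n n∣c+c') d∣c' , d∣n)

coprime-* : ∀ {x m n} → Coprime x m → Coprime x n → Coprime x (m * n)
coprime-* {x} {m} x⊥m x⊥n {d} (d∣x , d∣m*n) = x⊥n (d∣x , coprime-divisor d⊥m d∣m*n)
  where
  d⊥m : Coprime d m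
  d⊥m (e∣d , e∣m) = x⊥m (∣-trans e∣d d∣x , e∣m)

coprime-^ : ∀ {x m} → Coprime x m → ∀ j → Coprime x (m ^ j)
coprime-^ x⊥m zero    (_ , d∣1) = ∣1⇒≡1 d∣1
coprime-^ x⊥m (suc j) = coprime-* x⊥m (coprime-^ x⊥m j)

prime∤⇒coprime : ∀ {r x} → Prime r → ¬ r ∣ x → Coprime x r
prime∤⇒coprime r-prime r∤x (d∣x , d∣r) with prime⇒irreducible r-prime d∣r
... | inj₁ d≡1 = d≡1
... | inj₂ refl = contradiction d∣x r∤x

distinct-primes⇒coprime : ∀ {q₁ q₂} → Prime q₁ → Prime q₂ → q₁ ≢ q₂ → Coprime q₁ q₂
distinct-primes⇒coprime q₁-prime q₂-prime q₁≢q₂ (d∣q₁ , d∣q₂) with prime⇒irreducible q₁-prime d∣q₁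
... | inj₁ d≡1 = d≡1
... | inj₂ refl with prime⇒irreducible q₂-prime d∣q₂
...   | inj₁ q₁≡1 = contradiction q₁≡1 (prime≢1 q₁-prime)
...   | inj₂ q₁≡q₂ = contradiction q₁≡q₂ q₁≢q₂

bézout-idempotent : ∀ {q₁ q₂} .{{_ : NonZero q₁}} → Coprime q₁ q₂ → ∃[ u ] (q₁ ∣ u + 1 × q₂ ∣ u)
bézout-idempotent {suc s} {q₂} q₁⊥q₂ with coprime-Bézout q₁⊥q₂
... | Bézout.+- x y eq = y * q₂ , divides x (trans (+-comm (y * q₂) 1) eq) , n∣m*n y
... | Bézout.-+ x y eq = s * (y * q₂) , divides (1 + s * x) u+1≡ , ∣n⇒∣m*n s (n∣m*n y)
  where
  expand : ∀ s x → s * (1 + x * suc s) + 1 ≡ (1 + s * x) * suc s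
  expand = solve-∀
  u+1≡ : s * (y * q₂) + 1 ≡ (1 + s * x) * suc s
  u+1≡ = trans (cong (λ z → s * z + 1) (sym eq)) (expand s x)

chinese-remainder : ∀ {q₁ q₂} .{{_ : NonZero q₁}} .{{_ : NonZero q₂}} → Coprime q₁ q₂ →
                    ∀ A B → ∃[ t ] (q₁ ∣ t + A × q₂ ∣ t + B)
chinese-remainder {q₁} {q₂} q₁⊥q₂ A B
  with u , q₁∣u+1 , q₂∣u ← bézout-idempotent q₁⊥q₂
     | v , q₂∣v+1 , q₁∣v ← bézout-idempotent (coprime-sym q₁⊥q₂) =
  A * u + B * v ,
  subst (q₁ ∣_) (shift₁ A B u v) (∣m∣n⇒∣m+n (∣n⇒∣m*n A q₁∣u+1) (∣n⇒∣m*n B q₁∣v)) ,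
  subst (q₂ ∣_) (shift₂ A B u v) (∣m∣n⇒∣m+n (∣n⇒∣m*n A q₂∣u) (∣n⇒∣m*n B q₂∣v+1))
  where
  shift₁ : ∀ A B u v → A * (u + 1) + B * v ≡ A * u + B * v + A
  shift₁ = solve-∀
  shift₂ : ∀ A B u v → A * u + B * (v + 1) ≡ A * u + B * v + B
  shift₂ = solve-∀

same-side : ∀ {q} a b u v → q ∣ a + u → q ∣ a + v → q ∣ b + u → q ∣ b + v
same-side a b u v q∣a+u q∣a+v q∣b+u = ∣-rearrange (rearrange a b u v) q∣a+u q∣b+u q∣a+v
  where
  rearrange : ∀ a b u v → b + v + (a + u) ≡ b + u + (a + v)
  rearrange = solve-∀

opposite-side : ∀ {q} a b u ū v v̄ → q ∣ u + ū → q ∣ v + v̄ →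
                q ∣ a + u → q ∣ a + v → q ∣ b + ū → q ∣ b + v̄
opposite-side a b u ū v v̄ q∣u+ū q∣v+v̄ q∣a+u q∣a+v q∣b+ū =
  ∣-rearrange (rearrange a b u ū v v̄) (∣m∣n⇒∣m+n q∣a+v q∣u+ū) (∣m∣n⇒∣m+n q∣b+ū q∣a+u) q∣v+v̄
  where
  rearrange : ∀ a b u ū v v̄ → b + v̄ + (a + v + (u + ū)) ≡ b + ū + (a + u) + (v + v̄)
  rearrange = solve-∀

injective⇒surjective : ∀ {n} (f : Fin n → Fin n) → Injective _≡_ _≡_ f → ∀ y → ∃[ x ] f x ≡ y
injective⇒surjective {n} f f-injective y with any? (λ x → f x ≟ᶠ y)
... | yes hit = hit
... | no miss = contradiction (injective⇒≤ extend-injective) 1+n≰n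
  where
  extend : Fin (suc n) → Fin n
  extend zero    = y
  extend (suc x) = f x
  extend-injective : Injective _≡_ _≡_ extend
  extend-injective {zero}  {zero}   _  = refl
  extend-injective {zero}  {suc x'} eq = contradiction (x' , sym eq) miss
  extend-injective {suc x} {zero}   eq = contradiction (x , eq) miss
  extend-injective {suc x} {suc x'} eq = cong suc (f-injective eq)

disjoint-or-equal : ∀ {A B : ℕ → Set} → (∀ x → Dec (B x)) → ∃ A →
                    (∀ {x} → A x → B x → SameSet A B) →
                    (Disjoint A B × ¬ SameSet A B) ⊎ (SameSet A B × ¬ Disjoint A B)
disjoint-or-equal {A} {B} B? (a , Aa) same-if-meet with B? a
... | yes Ba = inj₂ (same-if-meet Aa Ba , λ disjoint → disjoint a Aa Ba)
... | no ¬Ba = inj₁ (disjoint , λ same → ¬Ba (proj₁ (same a) Aa))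
  where
  disjoint : Disjoint A B
  disjoint x Ax Bx = ¬Ba (proj₁ (same-if-meet Ax Bx a) Aa)

-- For n = p - 1, a generator γ and c' ≡ -c (mod n): γ^a ∈ 𝓜(γ^c) iff MExponent n c c' a.
record MExponent (n c c' a : ℕ) : Set where
  constructor mexponent
  field
    coprime       : Coprime a n
    ¬coprime-+2c  : ¬ Coprime (a + 2 * c) n
    ¬coprime-+2c' : ¬ Coprime (a + 2 * c') n

MExponent? : ∀ n c c' a → Dec (MExponent n c c' a)
MExponent? n c c' a with coprime? a n | coprime? (a + 2 * c) n | coprime? (a + 2 * c') n
... | yes a⊥n | no ¬a+2c⊥n | no ¬a+2c'⊥n = yes (mexponent a⊥n ¬a+2c⊥n ¬a+2c'⊥n)
... | no ¬a⊥n | _           | _            = no λ m → ¬a⊥n (MExponent.coprime m)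
... | yes _   | yes a+2c⊥n  | _            = no λ m → MExponent.¬coprime-+2c m a+2c⊥n
... | yes _   | no _        | yes a+2c'⊥n = no λ m → MExponent.¬coprime-+2c' m a+2c'⊥n

module DiscreteLog (n : ℕ) (p-prime : Prime (suc n)) (γ : ℕ) (γ-gen : IsGen (suc n) γ) where

  p : ℕ
  p = suc n

  instance
    n-nonZero : NonZero n
    n-nonZero = >-nonZero (s≤s⁻¹ (nonTrivial⇒n>1 p {{prime⇒nonTrivial p-prime}}))

  1%p≡1 : 1 % p ≡ 1
  1%p≡1 = m<n⇒m%n≡m (s≤s (>-nonZero⁻¹ n))

  unit? : ∀ x → Dec (Unit p x)
  unit? x = 0 <? x ×-dec x <? p

  unit⇒∤ : ∀ {x} → Unit p x → ¬ p ∣ x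
  unit⇒∤ (0<x , x<p) = >⇒∤ {{>-nonZero 0<x}} x<p

  infix 8 γ^_
  γ^_ : ℕ → ℕ
  γ^ a = γ ^ a % p

  -- Opaque: with-abstraction over these lemmas would otherwise unfold their costly proofs.
  opaque
    γ^-+ : ∀ a b → γ^ (a + b) ≡ γ^ a * γ^ b % p
    γ^-+ a b = trans (cong (_% p) (^-distribˡ-+-* γ a b)) (%-distribˡ-* (γ ^ a) (γ ^ b) p)

    γ^-^ : ∀ a k → (γ^ a) ^ k % p ≡ γ^ (a * k)
    γ^-^ a k = trans ([m%d]^k≡m^k (γ ^ a) k p) (cong (_% p) (^-*-assoc γ a k))

    γ^-unit : ∀ a → Unit p (γ^ a)
    γ^-unit a = n≢0⇒n>0 γ^a≢0 , m%n<n (γ ^ a) p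
      where
      γ^a≢0 : γ^ a ≢ 0
      γ^a≢0 γ^a≡0 = prime∤⇒∤^ p-prime (unit⇒∤ (proj₁ γ-gen)) a (m%n≡0⇒n∣m (γ ^ a) p γ^a≡0)

    γ^-cancel : ∀ a d → γ^ (a + d) ≡ γ^ a → γ^ d ≡ 1
    γ^-cancel a d γ^a+d≡γ^a = begin
      γ^ d      ≡⟨ m%n%n≡m%n (γ ^ d) p ⟨
      γ^ d % p  ≡⟨ *-cancelˡ-mod p-prime (unit⇒∤ (γ^-unit a)) γ^a*γ^d≡γ^a*1 ⟩
      1 % p     ≡⟨ 1%p≡1 ⟩
      1         ∎
      where
      γ^a*γ^d≡γ^a*1 : γ^ a * γ^ d ≡ γ^ a * 1 mod p
      γ^a*γ^d≡γ^a*1 = begin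
        γ^ a * γ^ d % p  ≡⟨ γ^-+ a d ⟨
        γ^ (a + d)       ≡⟨ γ^a+d≡γ^a ⟩
        γ^ a             ≡⟨ m%n%n≡m%n (γ ^ a) p ⟨
        γ^ a % p         ≡⟨ cong (_% p) (*-identityʳ (γ^ a)) ⟨
        γ^ a * 1 % p     ∎

    γ^-no-repeat : ∀ {a b} → a < b → b ∸ a < n → γ^ b ≢ γ^ a
    γ^-no-repeat {a} {b} a<b b∸a<n γ^b≡γ^a = proj₂ γ-gen (b ∸ a) (m<n⇒0<n∸m a<b) b∸a<n
      (γ^-cancel a (b ∸ a) (trans (cong γ^_ (m+[n∸m]≡n (<⇒≤ a<b))) γ^b≡γ^a))

    γ^-injective : ∀ {a b} → a < n → b < n → γ^ a ≡ γ^ b → a ≡ b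
    γ^-injective {a} {b} a<n b<n γ^a≡γ^b with <-cmp a b
    ... | tri< a<b _ _ = contradiction (sym γ^a≡γ^b) (γ^-no-repeat a<b (≤-<-trans (m∸n≤m b a) b<n))
    ... | tri≈ _ a≡b _ = a≡b
    ... | tri> _ _ b<a = contradiction γ^a≡γ^b (γ^-no-repeat b<a (≤-<-trans (m∸n≤m a b) a<n))

    unit-code : ∀ {x} → Unit p x → Fin n
    unit-code {suc x} (_ , s≤s x<n) = fromℕ< x<n

    unit-code-injective : ∀ {x y} (x-unit : Unit p x) (y-unit : Unit p y) →
                          unit-code x-unit ≡ unit-code y-unit → x ≡ y
    unit-code-injective {suc x} {suc y} (_ , s≤s x<n) (_ , s≤s y<n) eq =
      cong suc (fromℕ<-injective x y x<n y<n eq)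

    γ^-code : Fin n → Fin n
    γ^-code k = unit-code (γ^-unit (toℕ k))

    γ^-code-injective : Injective _≡_ _≡_ γ^-code
    γ^-code-injective {x} {y} eq = toℕ-injective (γ^-injective (toℕ<n x) (toℕ<n y)
      (unit-code-injective (γ^-unit (toℕ x)) (γ^-unit (toℕ y)) eq))

    γ^-surjective : ∀ {x} → Unit p x → ∃[ a ] (a < n × γ^ a ≡ x)
    γ^-surjective x-unit
      with k , eq ← injective⇒surjective γ^-code γ^-code-injective (unit-code x-unit) =
      toℕ k , toℕ<n k , unit-code-injective (γ^-unit (toℕ k)) x-unit eq

    γ^n≡1 : γ^ n ≡ 1
    γ^n≡1 with γ^-surjective (γ^-unit n)
    ... | zero  , _     , γ^0≡γ^n = trans (sym γ^0≡γ^n) 1%p≡1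
    ... | suc a , 1+a<n , γ^1+a≡γ^n =
      contradiction γ^1+a≡γ^n (≢-sym (γ^-no-repeat 1+a<n (∸-monoʳ-< z<s (<⇒≤ 1+a<n))))

    n∣⇒γ^≡1 : ∀ {a} → n ∣ a → γ^ a ≡ 1
    n∣⇒γ^≡1 (divides k refl) = begin
      γ^ (k * n)        ≡⟨ cong γ^_ (*-comm k n) ⟩
      γ^ (n * k)        ≡⟨ γ^-^ n k ⟨
      (γ^ n) ^ k % p    ≡⟨ cong (λ x → x ^ k % p) γ^n≡1 ⟩
      1 ^ k % p         ≡⟨ cong (_% p) (^-zeroˡ k) ⟩
      1 % p             ≡⟨ 1%p≡1 ⟩
      1                 ∎

    γ^-+-multiple : ∀ a {d} → n ∣ d → γ^ (a + d) ≡ γ^ a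
    γ^-+-multiple a {d} n∣d = begin
      γ^ (a + d)        ≡⟨ γ^-+ a d ⟩
      γ^ a * γ^ d % p   ≡⟨ cong (λ x → γ^ a * x % p) (n∣⇒γ^≡1 n∣d) ⟩
      γ^ a * 1 % p      ≡⟨ cong (_% p) (*-identityʳ (γ^ a)) ⟩
      γ^ a % p          ≡⟨ m%n%n≡m%n (γ ^ a) p ⟩
      γ^ a              ∎

    γ^-% : ∀ a → γ^ a ≡ γ^ (a % n)
    γ^-% a = trans (cong γ^_ (m≡m%n+[m/n]*n a n)) (γ^-+-multiple (a % n) (n∣m*n (a / n)))

    γ^-cong : ∀ {a b} → a ≡ b mod n → γ^ a ≡ γ^ b
    γ^-cong {a} {b} a≡b = trans (γ^-% a) (trans (cong γ^_ a≡b) (sym (γ^-% b)))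

    γ^-cong⁻¹ : ∀ {a b} → γ^ a ≡ γ^ b → a ≡ b mod n
    γ^-cong⁻¹ {a} {b} γ^a≡γ^b =
      γ^-injective (m%n<n a n) (m%n<n b n) (trans (sym (γ^-% a)) (trans γ^a≡γ^b (γ^-% b)))

    γ^≡1⇒n∣ : ∀ {a} → γ^ a ≡ 1 → n ∣ a
    γ^≡1⇒n∣ {a} γ^a≡1 = m%n≡0⇒n∣m a n
      (trans (γ^-cong⁻¹ {a} {0} (trans γ^a≡1 (sym 1%p≡1))) (m<n⇒m%n≡m (>-nonZero⁻¹ n)))

    γ^-product⁻¹ : ∀ d {a s} → γ^ a ≡ γ^ d * γ^ s % p → a ≡ d + s mod n
    γ^-product⁻¹ d {a} {s} eq = γ^-cong⁻¹ (trans eq (sym (γ^-+ d s)))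

    coprime⇒isGen : ∀ {a} → Coprime a n → IsGen p (γ^ a)
    coprime⇒isGen {a} a⊥n = γ^-unit a , λ k 0<k k<n γ^a^k≡1 →
      <⇒≱ k<n (∣⇒≤ {{>-nonZero 0<k}}
        (coprime-divisor (coprime-sym a⊥n) (γ^≡1⇒n∣ (trans (sym (γ^-^ a k)) γ^a^k≡1))))

    isGen⇒coprime : ∀ {a} → IsGen p (γ^ a) → Coprime a n
    isGen⇒coprime (_ , order) {zero}  (_ , divides k n≡k*0) =
      contradiction (trans n≡k*0 (*-zeroʳ k)) (≢-nonZero⁻¹ n)
    isGen⇒coprime (_ , order) {1}     _ = refl
    isGen⇒coprime {a} (_ , order) {d@(suc (suc _))} (d∣a , divides k n≡k*d) =
      contradiction γ^a^k≡1 (order k 0<k k<n)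
      where
      0<k : 0 < k
      0<k = n≢0⇒n>0 λ k≡0 → ≢-nonZero⁻¹ n (trans n≡k*d (cong (_* d) k≡0))
      k<n : k < n
      k<n = subst (k <_) (sym n≡k*d) (m<m*n k d {{>-nonZero 0<k}} (s≤s (s≤s z≤n)))
      γ^a^k≡1 : (γ^ a) ^ k % p ≡ 1
      γ^a^k≡1 = trans (γ^-^ a k)
        (n∣⇒γ^≡1 (subst (_∣ a * k) (trans (*-comm d k) (sym n≡k*d)) (*-monoˡ-∣ k d∣a)))

    product-isGen⇒coprime : ∀ {a b} → IsGen p (γ^ a * γ^ b % p) → Coprime (a + b) n
    product-isGen⇒coprime {a} {b} = isGen⇒coprime ∘ subst (IsGen p) (sym (γ^-+ a b))

    coprime⇒product-isGen : ∀ {a b} → Coprime (a + b) n → IsGen p (γ^ a * γ^ b % p)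
    coprime⇒product-isGen {a} {b} = subst (IsGen p) (γ^-+ a b) ∘ coprime⇒isGen

    generator-log : ∀ {g} → IsGen p g → ∃[ c ] (γ^ c ≡ g × Coprime c n)
    generator-log g-gen with c , _ , refl ← γ^-surjective (proj₁ g-gen) =
      c , refl , isGen⇒coprime g-gen

    square-root-unit : ∀ {y r} → Unit p r → y * y % p ≡ r → Unit p (y % p)
    square-root-unit {y} (0<r , _) y*y≡r = n≢0⇒n>0 y%p≢0 , m%n<n y p
      where
      y%p≢0 : y % p ≢ 0
      y%p≢0 y%p≡0 = <⇒≢ 0<r (begin
        0                      ≡⟨ cong (λ x → x * x % p) y%p≡0 ⟨
        (y % p) * (y % p) % p  ≡⟨ %-distribˡ-* y y p ⟨
        y * y % p              ≡⟨ y*y≡r ⟩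
        _                      ∎)

    isQR⇒exponent : ∀ {r} → IsQR p r → ∃[ s ] (2 ∣ s × r ≡ γ^ s)
    isQR⇒exponent {r} (r-unit , y , y*y≡r)
      with e , _ , γ^e≡y%p ← γ^-surjective (square-root-unit {y} r-unit y*y≡r) =
      e + e , divides e (m+m≡m*2 e) , (begin
        r                      ≡⟨ y*y≡r ⟨
        y * y % p              ≡⟨ %-distribˡ-* y y p ⟩
        (y % p) * (y % p) % p  ≡⟨ cong (λ x → x * x % p) γ^e≡y%p ⟨
        γ^ e * γ^ e % p        ≡⟨ γ^-+ e e ⟨
        γ^ (e + e)             ∎)

    γ^-isQR : ∀ {s} → 2 ∣ s → IsQR p (γ^ s)
    γ^-isQR (divides e refl) =
      γ^-unit (e * 2) , γ^ e , trans (sym (γ^-+ e e)) (cong γ^_ (m+m≡m*2 e))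

    isInv⇒exponent : ∀ {c h} → IsInv p (γ^ c) h → ∃[ c' ] (h ≡ γ^ c' × n ∣ c + c')
    isInv⇒exponent {c} (h-unit , γ^c*h≡1) with c' , _ , refl ← γ^-surjective h-unit =
      c' , refl , γ^≡1⇒n∣ (trans (γ^-+ c c') γ^c*h≡1)

    γ^-isInv : ∀ {c c'} → n ∣ c + c' → IsInv p (γ^ c) (γ^ c')
    γ^-isInv {c} {c'} n∣c+c' = γ^-unit c' , trans (sym (γ^-+ c c')) (n∣⇒γ^≡1 n∣c+c')

  exponent⇒Ig : ∀ {c c' s} → n ∣ c + c' → 2 ∣ s → Coprime (c + s) n → Coprime (c' + s) n →
                Ig p (γ^ c) (γ^ s)
  exponent⇒Ig {c} {c'} {s} n∣c+c' 2∣s c+s⊥n c'+s⊥n = ∈R c+s⊥n , ∈R-inverse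
    where
    ∈R : ∀ {d} → Coprime (d + s) n → Rg p (γ^ d) (γ^ s)
    ∈R {d} d+s⊥n = γ^-isQR 2∣s , coprime⇒product-isGen {d} {s} d+s⊥n
    ∈R-inverse : ∀ h → IsInv p (γ^ c) h → Rg p h (γ^ s)
    ∈R-inverse h h-inv with c'' , refl , n∣c+c'' ← isInv⇒exponent {c} h-inv =
      ∈R {c''} (coprime-mod {c' + s}
        (mod-+ʳ s {n} (negative-unique {c} {c'} {c''} n∣c+c' n∣c+c'')) c'+s⊥n)

  Ig⇒exponent : ∀ {c c' r} → n ∣ c + c' → Ig p (γ^ c) r →
       ∃[ s ] (r ≡ γ^ s × Coprime (c + s) n × Coprime (c' + s) n)
  Ig⇒exponent {c} {c'} n∣c+c' ((r-QR , γ^c*r-gen) , inverses)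
    with s , _ , refl ← isQR⇒exponent r-QR =
    s , refl , product-isGen⇒coprime {c} {s} γ^c*r-gen ,
    product-isGen⇒coprime {c'} {s} (proj₂ (inverses (γ^ c') (γ^-isInv {c} {c'} n∣c+c')))

  MExponent⇒Mg : ∀ {c c' a} → n ∣ c + c' → MExponent n c c' a → Mg p (γ^ c) (γ^ a)
  MExponent⇒Mg {c} {c'} {a} n∣c+c' (mexponent a⊥n ¬a+2c⊥n ¬a+2c'⊥n) =
    coprime⇒isGen a⊥n , not-excluded
    where
    not-excluded : ¬ (∃[ r ] (Ig p (γ^ c) r ×
                     (γ^ a ≡ (γ^ c * r) % p ⊎ ∃[ h ] (IsInv p (γ^ c) h × γ^ a ≡ (h * r) % p))))
    not-excluded (r , r∈I , a-form) with Ig⇒exponent {c} {c'} n∣c+c' r∈I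
    ... | s , refl , c+s⊥n , c'+s⊥n with a-form
    ...   | inj₁ γ^a≡γ^c*γ^s = ¬a+2c'⊥n (coprime-mod
            (sym (shift-by-negative c' c {a} (∣-+-comm c c' n∣c+c') (γ^-product⁻¹ c γ^a≡γ^c*γ^s)))
            c'+s⊥n)
    ...   | inj₂ (h , h-inv , γ^a≡h*γ^s) with c'' , refl , n∣c+c'' ← isInv⇒exponent {c} h-inv =
            ¬a+2c⊥n (coprime-mod
              (sym (shift-by-negative c c'' {a} n∣c+c'' (γ^-product⁻¹ c'' γ^a≡h*γ^s))) c+s⊥n)

  module _ (2∣n : 2 ∣ n) where

    -- With s = a + d (even, as a and d are odd), γ^a = γ^{d'} γ^s and γ^s ∈ 𝓘(γ^d).
    excluded-witness : ∀ {a d d'} → n ∣ d + d' → Coprime a n → Coprime d n → Coprime (a + 2 * d) n →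
                       2 ∣ a + d × Coprime (d + (a + d)) n × Coprime (d' + (a + d)) n ×
                       γ^ a ≡ γ^ d' * γ^ (a + d) % p
    excluded-witness {a} {d} {d'} n∣d+d' a⊥n d⊥n a+2d⊥n =
      odd+odd⇒2∣ (coprime-to-even⇒odd 2∣n a⊥n) (coprime-to-even⇒odd 2∣n d⊥n) ,
      subst (λ x → Coprime x n) (rearrange a d) a+2d⊥n ,
      coprime-mod (sym (cancel-negative {d} {d'} a n∣d+d')) a⊥n ,
      trans (γ^-cong {a} {d' + (a + d)} (sym (cancel-negative {d} {d'} a n∣d+d'))) (γ^-+ d' (a + d))
      where
      rearrange : ∀ a d → a + 2 * d ≡ d + (a + d)
      rearrange = solve-∀

    Mg⇒MExponent : ∀ {c c' a} → n ∣ c + c' → Coprime c n → Mg p (γ^ c) (γ^ a) → MExponent n c c' a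
    Mg⇒MExponent {c} {c'} {a} n∣c+c' c⊥n (a-gen , not-excluded) = mexponent a⊥n ¬a+2c⊥n ¬a+2c'⊥n
      where
      a⊥n : Coprime a n
      a⊥n = isGen⇒coprime a-gen
      ¬a+2c⊥n : ¬ Coprime (a + 2 * c) n
      ¬a+2c⊥n a+2c⊥n
        with 2∣s , c+s⊥n , c'+s⊥n , γ^a≡ ← excluded-witness {a} {c} {c'} n∣c+c' a⊥n c⊥n a+2c⊥n =
        not-excluded (γ^ (a + c) , exponent⇒Ig {c} {c'} n∣c+c' 2∣s c+s⊥n c'+s⊥n ,
                      inj₂ (γ^ c' , γ^-isInv {c} {c'} n∣c+c' , γ^a≡))
      ¬a+2c'⊥n : ¬ Coprime (a + 2 * c') n
      ¬a+2c'⊥n a+2c'⊥n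
        with 2∣s , c'+s⊥n , c+s⊥n , γ^a≡ ← excluded-witness {a} {c'} {c} (∣-+-comm c c' n∣c+c')
                                              a⊥n (coprime-negative {c} n∣c+c' c⊥n) a+2c'⊥n =
        not-excluded (γ^ (a + c') , exponent⇒Ig {c} {c'} n∣c+c' 2∣s c+s⊥n c'+s⊥n , inj₁ γ^a≡)

module TwoOddPrimes (n q₁ q₂ : ℕ) (q₁-prime : Prime q₁) (q₂-prime : Prime q₂) (q₁≢q₂ : q₁ ≢ q₂)
  (q₁-odd : q₁ % 2 ≡ 1) (q₂-odd : q₂ % 2 ≡ 1) (2∣n : 2 ∣ n) (q₁∣n : q₁ ∣ n) (q₂∣n : q₂ ∣ n)
  (coprime-to-n : ∀ {x} → ¬ 2 ∣ x → ¬ q₁ ∣ x → ¬ q₂ ∣ x → Coprime x n) where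

  odd-¬coprime⇒q₁∣⊎q₂∣ : ∀ {x} → ¬ 2 ∣ x → ¬ Coprime x n → q₁ ∣ x ⊎ q₂ ∣ x
  odd-¬coprime⇒q₁∣⊎q₂∣ {x} 2∤x ¬x⊥n with q₁ ∣? x | q₂ ∣? x
  ... | yes q₁∣x | _        = inj₁ q₁∣x
  ... | no _     | yes q₂∣x = inj₂ q₂∣x
  ... | no q₁∤x  | no q₂∤x  = ⊥-elim (¬x⊥n (coprime-to-n 2∤x q₁∤x q₂∤x))

  -- For u = 2c and v = -2c: a ≡ -2c (mod q₁) and a ≡ 2c (mod q₂).
  record Oriented (u v a : ℕ) : Set where
    constructor oriented
    field
      q₁∣a+u : q₁ ∣ a + u
      q₂∣a+v : q₂ ∣ a + v

  Orientation : ℕ → ℕ → ℕ → Set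
  Orientation u v a = Oriented u v a ⊎ Oriented v u a

  oriented-transfer : ∀ {u ū v v̄ a b} → n ∣ u + ū → n ∣ v + v̄ →
                      Oriented u ū a → Oriented v v̄ a → Orientation u ū b → Orientation v v̄ b
  oriented-transfer {u} {ū} {v} {v̄} {a} {b} _ _
    (oriented q₁∣a+u q₂∣a+ū) (oriented q₁∣a+v q₂∣a+v̄) (inj₁ (oriented q₁∣b+u q₂∣b+ū)) =
    inj₁ (oriented (same-side a b u v q₁∣a+u q₁∣a+v q₁∣b+u)
                   (same-side a b ū v̄ q₂∣a+ū q₂∣a+v̄ q₂∣b+ū))
  oriented-transfer {u} {ū} {v} {v̄} {a} {b} n∣u+ū n∣v+v̄
    (oriented q₁∣a+u q₂∣a+ū) (oriented q₁∣a+v q₂∣a+v̄) (inj₂ (oriented q₁∣b+ū q₂∣b+u)) =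
    inj₂ (oriented
      (opposite-side a b u ū v v̄ (∣-trans q₁∣n n∣u+ū) (∣-trans q₁∣n n∣v+v̄) q₁∣a+u q₁∣a+v q₁∣b+ū)
      (opposite-side a b ū u v̄ v (∣-trans q₂∣n (∣-+-comm u ū n∣u+ū))
        (∣-trans q₂∣n (∣-+-comm v v̄ n∣v+v̄)) q₂∣a+ū q₂∣a+v̄ q₂∣b+u))

  orientation-transfer : ∀ {u ū v v̄ a b} → n ∣ u + ū → n ∣ v + v̄ →
                         Orientation u ū a → Orientation v v̄ a →
                         Orientation u ū b → Orientation v v̄ b
  orientation-transfer n∣u+ū n∣v+v̄ (inj₁ a-u) (inj₁ a-v) b-u =
    oriented-transfer n∣u+ū n∣v+v̄ a-u a-v b-u
  orientation-transfer {v = v} {v̄} n∣u+ū n∣v+v̄ (inj₁ a-u) (inj₂ a-v̄) b-u =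
    ⊎-swap (oriented-transfer n∣u+ū (∣-+-comm v v̄ n∣v+v̄) a-u a-v̄ b-u)
  orientation-transfer {u} {ū} n∣u+ū n∣v+v̄ (inj₂ a-ū) (inj₁ a-v) b-u =
    oriented-transfer (∣-+-comm u ū n∣u+ū) n∣v+v̄ a-ū a-v (⊎-swap b-u)
  orientation-transfer {u} {ū} {v} {v̄} n∣u+ū n∣v+v̄ (inj₂ a-ū) (inj₂ a-v̄) b-u =
    ⊎-swap (oriented-transfer (∣-+-comm u ū n∣u+ū) (∣-+-comm v v̄ n∣v+v̄) a-ū a-v̄ (⊎-swap b-u))

  coprime⇒odd+2* : ∀ {a} → Coprime a n → ∀ w → ¬ 2 ∣ a + 2 * w
  coprime⇒odd+2* a⊥n w 2∣a+2w = coprime-to-even⇒odd 2∣n a⊥n (∣m+n∣n⇒∣m 2∣a+2w (m∣m*n w))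

  not-both-divisible : ∀ {q a} c c' → Prime q → q % 2 ≡ 1 → q ∣ n → n ∣ c + c' → Coprime a n →
                       q ∣ a + 2 * c → q ∣ a + 2 * c' → ⊥
  not-both-divisible {q} {a} c c' q-prime q-odd q∣n n∣c+c' a⊥n q∣a+2c q∣a+2c' =
    ∣⇒¬coprime (prime≢1 q-prime) (oddPrime∣2*a⇒∣a q-prime q-odd q∣2a) q∣n a⊥n
    where
    rearrange : ∀ a c c' → 2 * a + 2 * (c + c') ≡ a + 2 * c + (a + 2 * c')
    rearrange = solve-∀
    q∣2a : q ∣ 2 * a
    q∣2a = ∣-rearrange (rearrange a c c') (∣n⇒∣m*n 2 (∣-trans q∣n n∣c+c')) q∣a+2c q∣a+2c'

  MExponent⇒orientation : ∀ {c c' a} → n ∣ c + c' → MExponent n c c' a →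
                          Orientation (2 * c) (2 * c') a
  MExponent⇒orientation {c} {c'} n∣c+c' (mexponent a⊥n ¬a+2c⊥n ¬a+2c'⊥n)
    with odd-¬coprime⇒q₁∣⊎q₂∣ (coprime⇒odd+2* a⊥n c) ¬a+2c⊥n
       | odd-¬coprime⇒q₁∣⊎q₂∣ (coprime⇒odd+2* a⊥n c') ¬a+2c'⊥n
  ... | inj₁ q₁∣a+2c | inj₁ q₁∣a+2c' =
    ⊥-elim (not-both-divisible c c' q₁-prime q₁-odd q₁∣n n∣c+c' a⊥n q₁∣a+2c q₁∣a+2c')
  ... | inj₁ q₁∣a+2c | inj₂ q₂∣a+2c' = inj₁ (oriented q₁∣a+2c q₂∣a+2c')
  ... | inj₂ q₂∣a+2c | inj₁ q₁∣a+2c' = inj₂ (oriented q₁∣a+2c' q₂∣a+2c)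
  ... | inj₂ q₂∣a+2c | inj₂ q₂∣a+2c' =
    ⊥-elim (not-both-divisible c c' q₂-prime q₂-odd q₂∣n n∣c+c' a⊥n q₂∣a+2c q₂∣a+2c')

  orientation⇒MExponent : ∀ {c c' a} → Coprime a n → Orientation (2 * c) (2 * c') a →
                          MExponent n c c' a
  orientation⇒MExponent a⊥n (inj₁ (oriented q₁∣a+2c q₂∣a+2c')) =
    mexponent a⊥n (∣⇒¬coprime (prime≢1 q₁-prime) q₁∣a+2c q₁∣n)
                  (∣⇒¬coprime (prime≢1 q₂-prime) q₂∣a+2c' q₂∣n)
  orientation⇒MExponent a⊥n (inj₂ (oriented q₁∣a+2c' q₂∣a+2c)) =
    mexponent a⊥n (∣⇒¬coprime (prime≢1 q₂-prime) q₂∣a+2c q₂∣n)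
                  (∣⇒¬coprime (prime≢1 q₁-prime) q₁∣a+2c' q₁∣n)

  MExponent-transfer : ∀ {c c' d d' a b} → n ∣ c + c' → n ∣ d + d' →
                       MExponent n c c' a → MExponent n d d' a →
                       MExponent n c c' b → MExponent n d d' b
  MExponent-transfer {c} {c'} {d} {d'} n∣c+c' n∣d+d' a∈c a∈d b∈c =
    orientation⇒MExponent (MExponent.coprime b∈c)
      (orientation-transfer (double c c' n∣c+c') (double d d' n∣d+d')
        (MExponent⇒orientation n∣c+c' a∈c) (MExponent⇒orientation n∣d+d' a∈d)
        (MExponent⇒orientation n∣c+c' b∈c))
    where
    double : ∀ c c' → n ∣ c + c' → n ∣ 2 * c + 2 * c'
    double c c' n∣c+c' = subst (n ∣_) (*-distribˡ-+ 2 c c') (∣n⇒∣m*n 2 n∣c+c')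

  odd-solution : ∀ A B → ∃[ a ] (¬ 2 ∣ a × q₁ ∣ a + A × q₂ ∣ a + B)
  odd-solution A B
    with t , q₁∣t+A , q₂∣t+B ←
           chinese-remainder {{prime⇒nonZero q₁-prime}} {{prime⇒nonZero q₂-prime}}
             (distinct-primes⇒coprime q₁-prime q₂-prime q₁≢q₂) A B
    with 2 ∣? t
  ... | no 2∤t  = t , 2∤t , q₁∣t+A , q₂∣t+B
  ... | yes 2∣t = t + q₁ * q₂ , 2∤t+q₁q₂ , shift q₁∣t+A (m∣m*n q₂) , shift q₂∣t+B (n∣m*n q₁)
    where
    2∤t+q₁q₂ : ¬ 2 ∣ t + q₁ * q₂
    2∤t+q₁q₂ 2∣t+q₁q₂ with euclidsLemma q₁ q₂ prime[2] (∣m+n∣m⇒∣n 2∣t+q₁q₂ 2∣t)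
    ... | inj₁ 2∣q₁ = odd⇒2∤ q₁-odd 2∣q₁
    ... | inj₂ 2∣q₂ = odd⇒2∤ q₂-odd 2∣q₂
    rearrange : ∀ t X Q → t + X + Q ≡ t + Q + X
    rearrange = solve-∀
    shift : ∀ {q X} → q ∣ t + X → q ∣ q₁ * q₂ → q ∣ t + q₁ * q₂ + X
    shift {q} {X} q∣t+X q∣q₁q₂ = subst (q ∣_) (rearrange t X (q₁ * q₂)) (∣m∣n⇒∣m+n q∣t+X q∣q₁q₂)

  ∣a+2c⇒∤a : ∀ {q a c} → Prime q → q % 2 ≡ 1 → q ∣ n → Coprime c n → q ∣ a + 2 * c → ¬ q ∣ a
  ∣a+2c⇒∤a q-prime q-odd q∣n c⊥n q∣a+2c q∣a =
    ∣⇒¬coprime (prime≢1 q-prime) (oddPrime∣2*a⇒∣a q-prime q-odd (∣m+n∣m⇒∣n q∣a+2c q∣a)) q∣n c⊥n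

  MExponent-nonempty : ∀ {c c'} → Coprime c n → n ∣ c + c' → ∃ (MExponent n c c')
  MExponent-nonempty {c} {c'} c⊥n n∣c+c'
    with a , 2∤a , q₁∣a+2c , q₂∣a+2c' ← odd-solution (2 * c) (2 * c') =
    a , orientation⇒MExponent a⊥n (inj₁ (oriented q₁∣a+2c q₂∣a+2c'))
    where
    a⊥n : Coprime a n
    a⊥n = coprime-to-n 2∤a (∣a+2c⇒∤a q₁-prime q₁-odd q₁∣n c⊥n q₁∣a+2c)
                        (∣a+2c⇒∤a q₂-prime q₂-odd q₂∣n (coprime-negative n∣c+c' c⊥n) q₂∣a+2c')

  module Generators (p-prime : Prime (suc n)) (γ : ℕ) (γ-gen : IsGen (suc n) γ) where
    open DiscreteLog n p-prime γ γ-gen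

    Mg-log : ∀ {c c' x} → n ∣ c + c' → Coprime c n → Mg p (γ^ c) x →
             ∃[ a ] (γ^ a ≡ x × MExponent n c c' a)
    Mg-log n∣c+c' c⊥n x∈M with a , _ , refl ← γ^-surjective (proj₁ (proj₁ x∈M)) =
      a , refl , Mg⇒MExponent 2∣n n∣c+c' c⊥n x∈M

    Mg-transfer : ∀ {g h x y} → IsGen p g → IsGen p h → Mg p g x → Mg p h x → Mg p g y → Mg p h y
    Mg-transfer g-gen h-gen x∈Mg x∈Mh y∈Mg
      with c , refl , c⊥n ← generator-log g-gen
         | d , refl , d⊥n ← generator-log h-gen
      with a , refl , a∈c ← Mg-log (∣+negate c n) c⊥n x∈Mg
         | b , refl , b∈c ← Mg-log (∣+negate c n) c⊥n y∈Mg =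
      MExponent⇒Mg (∣+negate d n) (MExponent-transfer (∣+negate c n) (∣+negate d n)
        a∈c (Mg⇒MExponent 2∣n (∣+negate d n) d⊥n x∈Mh) b∈c)

    Mg-nonempty : ∀ {g} → IsGen p g → ∃ (Mg p g)
    Mg-nonempty g-gen with c , refl , c⊥n ← generator-log g-gen
                      with a , a∈c ← MExponent-nonempty c⊥n (∣+negate c n) =
      γ^ a , MExponent⇒Mg (∣+negate c n) a∈c

    Mg? : ∀ {g} → IsGen p g → ∀ x → Dec (Mg p g x)
    Mg? g-gen x with unit? x
    ... | no ¬x-unit = no (¬x-unit ∘ proj₁ ∘ proj₁)
    ... | yes x-unit with c , refl , c⊥n ← generator-log g-gen
                     with a , _ , refl ← γ^-surjective x-unit =
      map′ (MExponent⇒Mg (∣+negate c n)) (Mg⇒MExponent 2∣n (∣+negate c n) c⊥n)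
           (MExponent? n c (negate n c) a)

lemma5 : (p : ℕ) (pp : Prime p) (i j₁ j₂ q₁ q₂ : ℕ) →
    Prime q₁ → Prime q₂ → q₁ ≢ q₂ → q₁ % 2 ≡ 1 → q₂ % 2 ≡ 1 →
    1 ≤ i → 1 ≤ j₁ → 1 ≤ j₂ →
    p ∸ 1 ≡ 2 ^ i * q₁ ^ j₁ * q₂ ^ j₂ →
    (g₁ g₂ : ℕ) →
    IsGen p {{prime⇒nonZero pp}} g₁ → IsGen p {{prime⇒nonZero pp}} g₂ →
    (Disjoint (Mg p {{prime⇒nonZero pp}} g₁) (Mg p {{prime⇒nonZero pp}} g₂)
      × ¬ SameSet (Mg p {{prime⇒nonZero pp}} g₁) (Mg p {{prime⇒nonZero pp}} g₂))
    ⊎ (SameSet (Mg p {{prime⇒nonZero pp}} g₁) (Mg p {{prime⇒nonZero pp}} g₂)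
      × ¬ Disjoint (Mg p {{prime⇒nonZero pp}} g₁) (Mg p {{prime⇒nonZero pp}} g₂))
lemma5 zero () _ _ _ _ _ _ _ _ _ _ _ _ _ _ _ _ _ _
lemma5 (suc n) p-prime i j₁ j₂ q₁ q₂ q₁-prime q₂-prime q₁≢q₂ q₁-odd q₂-odd 1≤i 1≤j₁ 1≤j₂ n≡
       g₁ g₂ g₁-gen g₂-gen =
  disjoint-or-equal (Mg? g₂-gen) (Mg-nonempty g₁-gen)
    λ x∈M₁ x∈M₂ _ → Mg-transfer g₁-gen g₂-gen x∈M₁ x∈M₂ , Mg-transfer g₂-gen g₁-gen x∈M₂ x∈M₁
  where
  2∣n : 2 ∣ n
  2∣n = subst (2 ∣_) (sym n≡) (∣m⇒∣m*n (q₂ ^ j₂) (∣m⇒∣m*n (q₁ ^ j₁) (m∣m^n 1≤i)))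
  q₁∣n : q₁ ∣ n
  q₁∣n = subst (q₁ ∣_) (sym n≡) (∣m⇒∣m*n (q₂ ^ j₂) (∣n⇒∣m*n (2 ^ i) (m∣m^n 1≤j₁)))
  q₂∣n : q₂ ∣ n
  q₂∣n = subst (q₂ ∣_) (sym n≡) (∣n⇒∣m*n (2 ^ i * q₁ ^ j₁) (m∣m^n 1≤j₂))
  coprime-to-n : ∀ {x} → ¬ 2 ∣ x → ¬ q₁ ∣ x → ¬ q₂ ∣ x → Coprime x n
  coprime-to-n 2∤x q₁∤x q₂∤x = subst (Coprime _) (sym n≡) (coprime-*
    (coprime-* (coprime-^ (prime∤⇒coprime prime[2] 2∤x) i)
               (coprime-^ (prime∤⇒coprime q₁-prime q₁∤x) j₁))
    (coprime-^ (prime∤⇒coprime q₂-prime q₂∤x) j₂))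
  open TwoOddPrimes n q₁ q₂ q₁-prime q₂-prime q₁≢q₂ q₁-odd q₂-odd 2∣n q₁∣n q₂∣n coprime-to-n
  open Generators p-prime g₁ g₁-gen
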